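{- Let $P$ be an Eulerian poset and $I\subset P$ a proper ideal. Then the Bier poset $\mathcal B(P,I)$ is also an Eulerian poset.
   Context: All posets have finite length. A bounded poset is graded if all its maximal chains have the same length; a graded poset is Eulerian if every interval $[x,y]=\{z:x\le z\le y\}$ with $x<y$ has the same number of elements of odd rank and of even rank. An ideal of $P$ is a down-closed subset; it is proper if it is neither empty nor all of $P$. The Bier poset $\mathcal B(P,I)$ consists of all intervals $[x,y]\subseteq P$ with $x\in I$ and $y\notin I$, ordered by reversed inclusion ($[x',y']\le[x,y]$ iff $x'\le x<y\le y'$), together with an additional top element $\hat1$. -}

module Defs where

open import Data.Bool using (Bool; true; false; T; _∧_; not; if_then_else_)
open import Data.Bool.Properties using (T-irrelevant; T-∧; T?)
open import Data.Nat using (ℕ; zero; suc)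
open import Data.List using (List; []; _∷_; length; filterᵇ; deduplicateᵇ; cartesianProduct; mapMaybe)
open import Data.List.Membership.Propositional using (_∈_)
open import Data.List.Membership.Propositional.Properties using (∈-cartesianProduct⁺)
open import Data.List.Relation.Unary.All using (All)
open import Data.List.Relation.Unary.Any using (here; there)
open import Data.List.Relation.Unary.Linked using (Linked)
open import Data.Maybe using (Maybe; just; nothing)
open import Data.Product using (Σ; Σ-syntax; ∃; _×_; _,_; proj₁; proj₂)
open import Data.Sum using (_⊎_)
open import Data.Unit using (⊤; tt)
open import Data.Empty using (⊥)
open import Relation.Nullary using (¬_; yes; no)
open import Relation.Binary.PropositionalEquality using (_≡_; _≢_; refl; cong)
open import Function.Bundles using (Equivalence)

-- A finite poset is a carrier type with a decidable (Bool-valued) order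
-- relation satisfying the partial order axioms, together with a list
-- enumerating all its elements (repetitions allowed; counting is done
-- after removing duplicates).

record FinPoset : Set₁ where
  field
    Carrier  : Set
    _≤ᵇ_     : Carrier → Carrier → Bool
    ≤-refl   : ∀ x → T (x ≤ᵇ x)
    ≤-antisym : ∀ x y → T (x ≤ᵇ y) → T (y ≤ᵇ x) → x ≡ y
    ≤-trans  : ∀ x y z → T (x ≤ᵇ y) → T (y ≤ᵇ z) → T (x ≤ᵇ z)
    elems    : List Carrier
    elems-complete : ∀ x → x ∈ elems

  _≤_ : Carrier → Carrier → Set
  x ≤ y = T (x ≤ᵇ y)

  _<_ : Carrier → Carrier → Set
  x < y = x ≤ y × x ≢ y

  Chain : List Carrier → Set
  Chain = Linked _<_

  Comparable : Carrier → Carrier → Set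
  Comparable x y = x ≤ y ⊎ y ≤ x

  MaximalChainIn : (Carrier → Set) → List Carrier → Set
  MaximalChainIn S c =
    Chain c × All S c ×
    (∀ z → S z → (∀ w → w ∈ c → Comparable z w) → z ∈ c)

  MaximalChain : List Carrier → Set
  MaximalChain = MaximalChainIn (λ _ → ⊤)

  -- length of a chain x₀ < x₁ < ... < xₖ is k; we write length c ≡ suc k

  Bounded : Set
  Bounded = Σ[ b ∈ Carrier ] Σ[ t ∈ Carrier ] ((∀ x → b ≤ x) × (∀ x → x ≤ t))

  Graded : Set
  Graded = Bounded × Σ[ n ∈ ℕ ] (∀ c → MaximalChain c → length c ≡ suc n)

  IsRank : (Carrier → ℕ) → Set
  IsRank ρ = ∀ z c → MaximalChainIn (λ w → w ≤ z) c → length c ≡ suc (ρ z)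

  countIn : Carrier → Carrier → (Carrier → Bool) → ℕ
  countIn x y p =
    length (deduplicateᵇ (λ u v → u ≤ᵇ v ∧ v ≤ᵇ u)
             (filterᵇ (λ z → x ≤ᵇ z ∧ (z ≤ᵇ y ∧ p z)) elems))

isEven : ℕ → Bool
isEven zero = true
isEven (suc n) = not (isEven n)

module _ (P : FinPoset) where
  open FinPoset P

  Eulerian : Set
  Eulerian = Graded × Σ[ ρ ∈ (Carrier → ℕ) ] (IsRank ρ ×
    (∀ x y → x < y →
       countIn x y (λ z → isEven (ρ z)) ≡ countIn x y (λ z → not (isEven (ρ z)))))

  IsIdeal : (Carrier → Bool) → Set
  IsIdeal I = ∀ x y → x ≤ y → T (I y) → T (I x)

  IsProperIdeal : (Carrier → Bool) → Set
  IsProperIdeal I = IsIdeal I × (Σ[ x ∈ Carrier ] T (I x)) × (Σ[ y ∈ Carrier ] ¬ T (I y))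

private
  ∧-intro : ∀ {a b : Bool} → T a → T b → T (a ∧ b)
  ∧-intro {true} {true} _ _ = tt

  ∧-l : ∀ {a b : Bool} → T (a ∧ b) → T a
  ∧-l {true} _ = tt

  ∧-r : ∀ {a b : Bool} → T (a ∧ b) → T b
  ∧-r {true} p = p

  mapMaybe-∈ : ∀ {A B : Set} (f : A → Maybe B) {xs : List A} {a : A} {b : B} →
               a ∈ xs → f a ≡ just b → b ∈ mapMaybe f xs
  mapMaybe-∈ f {x ∷ xs} (here refl) eq with f x
  mapMaybe-∈ f {x ∷ xs} (here refl) refl | just _ = here refl
  mapMaybe-∈ f {x ∷ xs} (there a∈) eq with f x
  ... | nothing = mapMaybe-∈ f a∈ eq
  ... | just _  = there (mapMaybe-∈ f a∈ eq)

-- The Bier poset B(P, I): intervals [x,y] with x ∈ I, y ∉ I (and x ≤ y),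
-- ordered by reversed inclusion, plus an extra top element (nothing).

module _ (P : FinPoset) (I : FinPoset.Carrier P → Bool) where
  open FinPoset P

  bierCond : Carrier → Carrier → Bool
  bierCond x y = I x ∧ (not (I y) ∧ (x ≤ᵇ y))

  BierInterval : Set
  BierInterval = Σ[ xy ∈ Carrier × Carrier ] T (bierCond (proj₁ xy) (proj₂ xy))

  BierCarrier : Set
  BierCarrier = Maybe BierInterval

  _≤ᴮ_ : BierCarrier → BierCarrier → Bool
  _ ≤ᴮ nothing = true
  nothing ≤ᴮ just _ = false
  just ((a , b) , _) ≤ᴮ just ((c , d) , _) = a ≤ᵇ c ∧ d ≤ᵇ b

  private
    brefl : ∀ u → T (u ≤ᴮ u)
    brefl nothing = tt
    brefl (just ((a , b) , _)) = ∧-intro (≤-refl a) (≤-refl b)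

    bantisym : ∀ u v → T (u ≤ᴮ v) → T (v ≤ᴮ u) → u ≡ v
    bantisym nothing nothing _ _ = refl
    bantisym (just ((a , b) , p)) (just ((c , d) , q)) h k
      with ≤-antisym a c (∧-l h) (∧-l k) | ≤-antisym b d (∧-r k) (∧-r h)
    ... | refl | refl = cong (λ r → just ((a , b) , r)) (T-irrelevant p q)

    btrans : ∀ u v w → T (u ≤ᴮ v) → T (v ≤ᴮ w) → T (u ≤ᴮ w)
    btrans u v nothing _ _ = tt
    btrans (just ((a , b) , _)) (just ((c , d) , _)) (just ((e , f) , _)) h k =
      ∧-intro (≤-trans a c e (∧-l h) (∧-l k)) (≤-trans f d b (∧-r k) (∧-r h))

    mk : Carrier × Carrier → Maybe BierCarrier
    mk (x , y) with T? (bierCond x y)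
    ... | yes p = just (just ((x , y) , p))
    ... | no _  = nothing

    mk-ok : ∀ x y (p : T (bierCond x y)) → mk (x , y) ≡ just (just ((x , y) , p))
    mk-ok x y p with T? (bierCond x y)
    ... | yes q = cong (λ r → just (just ((x , y) , r))) (T-irrelevant q p)
    ... | no np with () ← np p

    belems : List BierCarrier
    belems = nothing ∷ mapMaybe mk (cartesianProduct elems elems)

    bcomplete : ∀ u → u ∈ belems
    bcomplete nothing = here refl
    bcomplete (just ((x , y) , p)) =
      there (mapMaybe-∈ mk (∈-cartesianProduct⁺ (elems-complete x) (elems-complete y))
                        (mk-ok x y p))

  Bier : FinPoset
  Bier = record
    { Carrier = BierCarrier
    ; _≤ᵇ_ = _≤ᴮ_
    ; ≤-refl = brefl
    ; ≤-antisym = bantisym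
    ; ≤-trans = btrans
    ; elems = belems
    ; elems-complete = bcomplete
    }

-- Write s(z) = (-1)^ρ(z).  For a ranked poset, being Eulerian says exactly that the alternating
-- sum of s over every interval [x,y] with x < y vanishes, so in P that sum is s(x) if x = y and 0
-- otherwise.  The Bier poset is ranked by ρ[u,v] = ρ(u) + ρ(1̂) - ρ(v), with ρ(1̂ᴮ) = ρ(1̂): a cover
-- in B moves one end of an interval along a cover of P, and [u,v] ⋖ 1̂ᴮ exactly when u ⋖ v.
-- Between two intervals [x,y] ≤ [x′,y′], every pair with x ≤ u ≤ x′ and y′ ≤ v ≤ y is a Bier
-- interval, so the alternating sum over that interval of B factors as
-- ±(Σ_{x≤u≤x′} s(u))(Σ_{y′≤v≤y} s(v)), which vanishes unless the two intervals coincide.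
-- Above [x,y], since I is an ideal, [u ∈ I][v ∉ I] = [u ∈ I] - [v ∈ I] whenever u ≤ v.  The first
-- part contributes sums Σ_{u≤v≤y} s(v) with u ∈ I ∌ y, hence 0; the second contributes
-- Σ_{v ∈ I, v ≤ y} s(v) Σ_{x≤u≤v} s(u), in which only v = x survives, giving -1.  Up to the
-- common factor s(1̂) this cancels the term of 1̂ᴮ.  The rank facts used about P follow from the
-- existence of saturated chains.

module Submission where

open import Data.Bool using (Bool; true; false; T; _∧_; not)
open import Data.Bool.Properties using (T?; T-∧; T-irrelevant; ∧-assoc; ∧-identityʳ)
open import Data.Integer as ℤ using (ℤ; 0ℤ; 1ℤ; -1ℤ; _+_; _*_; _-_; _^_)
import Data.Integer.Properties as ℤₚ
open import Data.Integer.Tactic.RingSolver using (solve-∀)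
open import Data.List
  using (List; []; _∷_; length; filter; filterᵇ; deduplicateᵇ; map; mapMaybe; cartesianProduct; _++_; _∷ʳ_)
open import Data.List.Properties using (length-++)
open import Data.List.Membership.Propositional using (_∈_)
open import Data.List.Membership.Propositional.Properties
  using (∈-map⁺; ∈-map⁻; ∈-cartesianProduct⁺; ∈-filter⁺; ∈-filter⁻; ∈-deduplicate⁻)
open import Data.List.Membership.Propositional.Properties.WithK using (unique∧set⇒bag)
import Data.List.Membership.Setoid.Properties as SetoidMembership
open import Data.List.Relation.Binary.BagAndSetEquality using (∼bag⇒↭)
open import Data.List.Relation.Binary.Permutation.Propositional.Properties using (↭-length)
open import Data.List.Relation.Unary.All as All using (All; []; _∷_)
open import Data.List.Relation.Unary.All.Properties using (all-filter)
open import Data.List.Relation.Unary.AllPairs using () renaming (_∷_ to _∷ᴬ_)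
open import Data.List.Relation.Unary.Any using (here; there)
open import Data.List.Relation.Unary.Linked using ([-]; _∷_)
open import Data.List.Relation.Unary.Linked.Properties using (Linked⇒AllPairs)
open import Data.List.Relation.Unary.Unique.Propositional using (Unique; []; _∷_)
import Data.List.Relation.Unary.Unique.Propositional.Properties as Unique
open import Data.Maybe using (Maybe; just; nothing)
open import Data.Maybe.Properties using (just-injective)
open import Data.Nat as ℕ using (ℕ; zero; suc)
import Data.Nat.Properties as ℕₚ
open import Data.Product using (Σ; ∃; ∃-syntax; _×_; _,_; proj₁; proj₂)
open import Data.Sum as Sum using (_⊎_; inj₁; inj₂; [_,_]′)
open import Data.Unit using (tt)
open import Function using (_∘_)
open import Function.Bundles using (_⇔_; mk⇔; Equivalence)
open import Level using (0ℓ)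
open import Relation.Binary.Bundles using (Poset)
open import Relation.Binary.Definitions using (DecidableEquality) renaming (Decidable to Decidable₂)
import Relation.Binary.Construct.NonStrictToStrict as ToStrict
import Relation.Binary.Properties.Poset as PosetProperties
open import Relation.Binary.PropositionalEquality
  using (_≡_; _≢_; refl; cong; cong₂; sym; trans; subst; setoid; isEquivalence; module ≡-Reasoning)
open import Relation.Nullary using (¬_; yes; no; contradiction; _×-dec_)
open import Relation.Unary using (Pred; Decidable)

open import Defs

open Equivalence using (to; from)

private
  variable
    A B : Set

-- Sums over lists and Iverson brackets

infix 5 ∑
∑ : List A → (A → ℤ) → ℤ
∑ []       f = 0ℤ
∑ (x ∷ xs) f = f x + ∑ xs f

syntax ∑ xs (λ x → e) = ∑[ x ∈ xs ] e

⟦_⟧ : Bool → ℤ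
⟦ true  ⟧ = 1ℤ
⟦ false ⟧ = 0ℤ

⟦⟧-∧ : ∀ a b → ⟦ a ∧ b ⟧ ≡ ⟦ a ⟧ * ⟦ b ⟧
⟦⟧-∧ true  b = sym (ℤₚ.*-identityˡ ⟦ b ⟧)
⟦⟧-∧ false b = refl

⟦⟧-not : ∀ a → ⟦ not a ⟧ ≡ 1ℤ - ⟦ a ⟧
⟦⟧-not true  = refl
⟦⟧-not false = refl

T-not : ∀ {a} → T (not a) ⇔ (¬ T a)
T-not {true}  = mk⇔ (λ ()) (λ ¬a → ¬a _)
T-not {false} = mk⇔ (λ _ ()) _

⟦⟧-true : ∀ {a} → T a → ⟦ a ⟧ ≡ 1ℤ
⟦⟧-true {true} _ = refl

⟦⟧-absorbˡ : ∀ {a b} → (T b → T a) → ⟦ a ⟧ * ⟦ b ⟧ ≡ ⟦ b ⟧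
⟦⟧-absorbˡ {a} {true}  b⇒a = cong (_* 1ℤ) (⟦⟧-true (b⇒a _))
⟦⟧-absorbˡ {a} {false} _   = ℤₚ.*-zeroʳ ⟦ a ⟧

⟦⟧*-true : ∀ {a} → T a → ∀ z → ⟦ a ⟧ * z ≡ z
⟦⟧*-true {true} _ z = ℤₚ.*-identityˡ z

⟦⟧*-vanish : ∀ {a} z → (T a → z ≡ 0ℤ) → ⟦ a ⟧ * z ≡ 0ℤ
⟦⟧*-vanish {true}  z a⇒z≡0 = trans (ℤₚ.*-identityˡ z) (a⇒z≡0 _)
⟦⟧*-vanish {false} z _     = refl

module _ {f g : A → ℤ} where

  ∑-cong : ∀ xs → (∀ x → f x ≡ g x) → ∑ xs f ≡ ∑ xs g
  ∑-cong []       f≗g = refl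
  ∑-cong (x ∷ xs) f≗g = cong₂ _+_ (f≗g x) (∑-cong xs f≗g)

  ∑-+ : ∀ xs → ∑[ x ∈ xs ] (f x + g x) ≡ ∑ xs f + ∑ xs g
  ∑-+ []       = refl
  ∑-+ (x ∷ xs) = trans (cong ((f x + g x) +_) (∑-+ xs)) (interchange (f x) (g x) (∑ xs f) (∑ xs g))
    where
    interchange : ∀ a b c d → (a + b) + (c + d) ≡ (a + c) + (b + d)
    interchange = solve-∀

  ∑-- : ∀ xs → ∑[ x ∈ xs ] (f x - g x) ≡ ∑ xs f - ∑ xs g
  ∑-- []       = refl
  ∑-- (x ∷ xs) = trans (cong ((f x - g x) +_) (∑-- xs)) (interchange (f x) (g x) (∑ xs f) (∑ xs g))
    where
    interchange : ∀ a b c d → (a - b) + (c - d) ≡ (a + c) - (b + d)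
    interchange = solve-∀

∑-zero : ∀ {xs} {f : A → ℤ} → All (λ x → f x ≡ 0ℤ) xs → ∑ xs f ≡ 0ℤ
∑-zero []             = refl
∑-zero (fx≡0 ∷ fxs≡0) = cong₂ _+_ fx≡0 (∑-zero fxs≡0)

∑-*ˡ : ∀ xs c (f : A → ℤ) → ∑[ x ∈ xs ] (c * f x) ≡ c * ∑ xs f
∑-*ˡ []       c f = sym (ℤₚ.*-zeroʳ c)
∑-*ˡ (x ∷ xs) c f = trans (cong (c * f x +_) (∑-*ˡ xs c f)) (sym (ℤₚ.*-distribˡ-+ c (f x) (∑ xs f)))

∑-*ʳ : ∀ xs c (f : A → ℤ) → ∑[ x ∈ xs ] (f x * c) ≡ ∑ xs f * c
∑-*ʳ []       c f = refl
∑-*ʳ (x ∷ xs) c f = trans (cong (f x * c +_) (∑-*ʳ xs c f)) (sym (ℤₚ.*-distribʳ-+ c (f x) (∑ xs f)))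

∑-product : ∀ xs ys (f : A → ℤ) (g : B → ℤ) → ∑[ x ∈ xs ] ∑[ y ∈ ys ] (f x * g y) ≡ ∑ xs f * ∑ ys g
∑-product xs ys f g = trans (∑-cong xs (λ x → ∑-*ˡ ys (f x) g)) (∑-*ʳ xs (∑ ys g) f)

∑∑-*ˡ : ∀ xs ys c (f : A → B → ℤ) → ∑[ x ∈ xs ] ∑[ y ∈ ys ] (c * f x y) ≡ c * (∑[ x ∈ xs ] ∑[ y ∈ ys ] f x y)
∑∑-*ˡ xs ys c f = trans (∑-cong xs (λ x → ∑-*ˡ ys c (f x))) (∑-*ˡ xs c _)

∑-++ : ∀ xs ys (f : A → ℤ) → ∑ (xs ++ ys) f ≡ ∑ xs f + ∑ ys f
∑-++ []       ys f = sym (ℤₚ.+-identityˡ (∑ ys f))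
∑-++ (x ∷ xs) ys f = trans (cong (f x +_) (∑-++ xs ys f)) (sym (ℤₚ.+-assoc (f x) (∑ xs f) (∑ ys f)))

∑-map : ∀ xs (h : A → B) (f : B → ℤ) → ∑ (map h xs) f ≡ ∑ xs (f ∘ h)
∑-map []       h f = refl
∑-map (x ∷ xs) h f = cong (f (h x) +_) (∑-map xs h f)

∑-swap : ∀ xs ys (f : A → B → ℤ) → ∑[ x ∈ xs ] ∑[ y ∈ ys ] f x y ≡ ∑[ y ∈ ys ] ∑[ x ∈ xs ] f x y
∑-swap []       ys f = sym (∑-zero (All.tabulate {xs = ys} (λ _ → refl)))
∑-swap (x ∷ xs) ys f = trans (cong (∑ ys (f x) +_) (∑-swap xs ys f)) (sym (∑-+ ys))

∑-cartesianProduct : ∀ xs ys (f : A × B → ℤ) →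
                     ∑ (cartesianProduct xs ys) f ≡ ∑[ x ∈ xs ] ∑[ y ∈ ys ] f (x , y)
∑-cartesianProduct []       ys f = refl
∑-cartesianProduct (x ∷ xs) ys f = begin
  ∑ (map (x ,_) ys ++ cartesianProduct xs ys) f  ≡⟨ ∑-++ (map (x ,_) ys) _ f ⟩
  ∑ (map (x ,_) ys) f + ∑ (cartesianProduct xs ys) f
    ≡⟨ cong₂ _+_ (∑-map ys (x ,_) f) (∑-cartesianProduct xs ys f) ⟩
  (∑[ y ∈ ys ] f (x , y)) + (∑[ x ∈ xs ] ∑[ y ∈ ys ] f (x , y))  ∎
  where open ≡-Reasoning

∑-unique-support : ∀ {xs a} {f : A → ℤ} → Unique xs → a ∈ xs →
                   (∀ x → x ≢ a → f x ≡ 0ℤ) → ∑ xs f ≡ f a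
∑-unique-support {f = f} (a∉xs ∷ _) (here refl) vanish =
  trans (cong (f _ +_) (∑-zero (All.map (λ a≢x → vanish _ (a≢x ∘ sym)) a∉xs))) (ℤₚ.+-identityʳ _)
∑-unique-support {f = f} (x∉xs ∷ xs!) (there a∈xs) vanish =
  trans (cong₂ _+_ (vanish _ (All.lookup x∉xs a∈xs)) (∑-unique-support xs! a∈xs vanish))
        (ℤₚ.+-identityˡ _)

length-filterᵇ : ∀ (c : A → Bool) xs → ℤ.+ length (filterᵇ c xs) ≡ ∑[ x ∈ xs ] ⟦ c x ⟧
length-filterᵇ c []       = refl
length-filterᵇ c (x ∷ xs) with c x
... | true  = cong (1ℤ +_) (length-filterᵇ c xs)
... | false = trans (length-filterᵇ c xs) (sym (ℤₚ.+-identityˡ _))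

⟦⟧-parity : ∀ c k → ⟦ c ∧ isEven k ⟧ - ⟦ c ∧ not (isEven k) ⟧ ≡ ⟦ c ⟧ * -1ℤ ^ k
⟦⟧-parity false k = refl
⟦⟧-parity true  k = trans (parity k) (sym (ℤₚ.*-identityˡ (-1ℤ ^ k)))
  where
  parity : ∀ k → ⟦ isEven k ⟧ - ⟦ not (isEven k) ⟧ ≡ -1ℤ ^ k
  parity zero    = refl
  parity (suc k) with isEven k | parity k
  ... | true  | eq = cong (-1ℤ *_) eq
  ... | false | eq = cong (-1ℤ *_) eq

-1^-square : ∀ k → -1ℤ ^ k * -1ℤ ^ k ≡ 1ℤ
-1^-square zero    = refl
-1^-square (suc k) = trans (square-neg (-1ℤ ^ k)) (-1^-square k)
  where
  square-neg : ∀ a → (-1ℤ * a) * (-1ℤ * a) ≡ a * a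
  square-neg = solve-∀

-1^-∸ : ∀ {m n} → m ℕ.≤ n → -1ℤ ^ (n ℕ.∸ m) ≡ -1ℤ ^ m * -1ℤ ^ n
-1^-∸ {m} {n} m≤n = begin
  -1ℤ ^ (n ℕ.∸ m)                          ≡⟨ sym (ℤₚ.*-identityˡ _) ⟩
  1ℤ * -1ℤ ^ (n ℕ.∸ m)                     ≡⟨ cong (_* -1ℤ ^ (n ℕ.∸ m)) (sym (-1^-square m)) ⟩
  (-1ℤ ^ m * -1ℤ ^ m) * -1ℤ ^ (n ℕ.∸ m)    ≡⟨ ℤₚ.*-assoc (-1ℤ ^ m) _ _ ⟩
  -1ℤ ^ m * (-1ℤ ^ m * -1ℤ ^ (n ℕ.∸ m))    ≡⟨ cong (-1ℤ ^ m *_) (sym (ℤₚ.^-distribˡ-+-* -1ℤ m (n ℕ.∸ m))) ⟩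
  -1ℤ ^ m * -1ℤ ^ (m ℕ.+ (n ℕ.∸ m))        ≡⟨ cong (λ k → -1ℤ ^ m * -1ℤ ^ k) (ℕₚ.m+[n∸m]≡n m≤n) ⟩
  -1ℤ ^ m * -1ℤ ^ n                         ∎
  where open ≡-Reasoning

module _ {P Q : Pred A 0ℓ} (P? : Decidable P) (Q? : Decidable Q) (P⊆Q : ∀ {x} → P x → Q x) where

  length-filter-mono : ∀ xs → length (filter P? xs) ℕ.≤ length (filter Q? xs)
  length-filter-mono []       = ℕ.z≤n
  length-filter-mono (x ∷ xs) with P? x | Q? x
  ... | yes _  | yes _   = ℕ.s≤s (length-filter-mono xs)
  ... | yes Px | no ¬Qx = contradiction (P⊆Q Px) ¬Qx
  ... | no _   | yes _   = ℕₚ.m≤n⇒m≤1+n (length-filter-mono xs)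
  ... | no _   | no _    = length-filter-mono xs

  length-filter-strict : ∀ {xs a} → a ∈ xs → Q a → ¬ P a →
                         length (filter P? xs) ℕ.< length (filter Q? xs)
  length-filter-strict {x ∷ xs} a∈ Qa ¬Pa with P? x | Q? x | a∈
  ... | yes Px | _      | here refl   = contradiction Px ¬Pa
  ... | no _   | yes _  | here refl   = ℕ.s≤s (length-filter-mono xs)
  ... | no _   | no ¬Qx | here refl   = contradiction Qa ¬Qx
  ... | yes _  | yes _  | there a∈xs = ℕ.s≤s (length-filter-strict a∈xs Qa ¬Pa)
  ... | yes Px | no ¬Qx | there _    = contradiction (P⊆Q Px) ¬Qx
  ... | no _   | yes _  | there a∈xs = ℕₚ.m≤n⇒m≤1+n (length-filter-strict a∈xs Qa ¬Pa)
  ... | no _   | no _   | there a∈xs = length-filter-strict a∈xs Qa ¬Pa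

-- Enumerations of finite types

record Enumeration (A : Set) : Set where
  field
    list     : List A
    unique   : Unique list
    complete : ∀ x → x ∈ list

open Enumeration

enumerateMaybe : Enumeration A → Enumeration (Maybe A)
enumerateMaybe E = record
  { list     = nothing ∷ map just (list E)
  ; unique   = All.tabulate nothing∉ ∷ Unique.map⁺ just-injective (unique E)
  ; complete = λ { nothing → here refl ; (just x) → there (∈-map⁺ just (complete E x)) }
  }
  where
  nothing∉ : ∀ {y} → y ∈ map just (list E) → nothing ≢ y
  nothing∉ y∈ refl with ∈-map⁻ just y∈
  ... | _ , _ , ()

enumerate× : Enumeration A → Enumeration B → Enumeration (A × B)
enumerate× E F = record
  { list     = cartesianProduct (list E) (list F)
  ; unique   = Unique.cartesianProduct⁺ (unique E) (unique F)
  ; complete = λ (x , y) → ∈-cartesianProduct⁺ (complete E x) (complete F y)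
  }

restrict : (c : A → Bool) → A → Maybe (Σ A (T ∘ c))
restrict c x with T? (c x)
... | yes cx = just (x , cx)
... | no  _  = nothing

module _ (c : A → Bool) where

  ∈-restrict⁺ : ∀ {xs x} (cx : T (c x)) → x ∈ xs → (x , cx) ∈ mapMaybe (restrict c) xs
  ∈-restrict⁺ {y ∷ xs} cx x∈ with T? (c y) | x∈
  ... | yes cy | here refl   = here (cong (_ ,_) (T-irrelevant cx cy))
  ... | yes _  | there x∈xs = there (∈-restrict⁺ cx x∈xs)
  ... | no ¬cy | here refl   = contradiction cx ¬cy
  ... | no _   | there x∈xs = ∈-restrict⁺ cx x∈xs

  ∈-restrict⁻ : ∀ {xs y} → y ∈ mapMaybe (restrict c) xs → proj₁ y ∈ xs
  ∈-restrict⁻ {x ∷ xs} y∈ with T? (c x) | y∈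
  ... | yes _ | here refl   = here refl
  ... | yes _ | there y∈ys = there (∈-restrict⁻ y∈ys)
  ... | no _  | y∈ys        = there (∈-restrict⁻ y∈ys)

  unique-restrict : ∀ {xs} → Unique xs → Unique (mapMaybe (restrict c) xs)
  unique-restrict []                          = []
  unique-restrict {x ∷ xs} (x∉xs ∷ xs!) with T? (c x)
  ... | yes _ = All.tabulate (λ y∈ys → λ { refl → All.lookup x∉xs (∈-restrict⁻ y∈ys) refl })
                ∷ unique-restrict xs!
  ... | no _  = unique-restrict xs!

  ∑-restrict : ∀ xs {g : Σ A (T ∘ c) → ℤ} {G : A → ℤ} → (∀ x cx → g (x , cx) ≡ G x) →
               ∑ (mapMaybe (restrict c) xs) g ≡ ∑[ x ∈ xs ] ⟦ c x ⟧ * G x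
  ∑-restrict []       g≗G = refl
  ∑-restrict (x ∷ xs) {G = G} g≗G with T? (c x)
  ... | yes cx = cong₂ _+_ (trans (g≗G x cx) (sym (⟦⟧*-true cx (G x)))) (∑-restrict xs g≗G)
  ... | no ¬cx = trans (sym (ℤₚ.+-identityˡ _))
                   (cong₂ _+_ (sym (⟦⟧*-vanish (G x) (λ cx → contradiction cx ¬cx))) (∑-restrict xs g≗G))

  enumerateΣ : Enumeration A → Enumeration (Σ A (T ∘ c))
  enumerateΣ E = record
    { list     = mapMaybe (restrict c) (list E)
    ; unique   = unique-restrict (unique E)
    ; complete = λ (x , cx) → ∈-restrict⁺ cx (complete E x)
    }

-- Finite posets: counting, saturated chains and ranks

module FinPosetProperties (Q : FinPoset) where
  open FinPoset Q

  poset : Poset 0ℓ 0ℓ 0ℓ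
  poset = record
    { _≈_            = _≡_
    ; _≤_            = _≤_
    ; isPartialOrder = record
      { isPreorder = record
        { isEquivalence = isEquivalence
        ; reflexive     = λ { refl → ≤-refl _ }
        ; trans         = λ {x y z} → ≤-trans x y z
        }
      ; antisym    = λ {x y} → ≤-antisym x y
      }
    }

  open PosetProperties poset using (<⇒≱; <-trans; ≤-dec⇒≈-dec)

  _≤?_ : Decidable₂ _≤_
  x ≤? y = T? (x ≤ᵇ y)

  _≟_ : DecidableEquality Carrier
  _≟_ = ≤-dec⇒≈-dec _≤?_

  _<?_ : Decidable₂ _<_
  _<?_ = ToStrict.<-decidable _≡_ _≤_ _≟_ _≤?_

  <-≤-trans : ∀ {x y z} → x < y → y ≤ z → x < z
  <-≤-trans = ToStrict.<-≤-trans _≡_ _≤_ sym (λ {x y z} → ≤-trans x y z) (λ {x y} → ≤-antisym x y)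
                (λ { refl y≤z → y≤z })

  -- The relation by which countIn deduplicates; it is equality, by antisymmetry.
  _≈ᵇ_ : Carrier → Carrier → Bool
  x ≈ᵇ y = x ≤ᵇ y ∧ y ≤ᵇ x

  ≈ᵇ⇒≡ : ∀ {x y} → T (x ≈ᵇ y) → x ≡ y
  ≈ᵇ⇒≡ {x} {y} x≈y = let (x≤y , y≤x) = to T-∧ x≈y in ≤-antisym x y x≤y y≤x

  ≡⇒≈ᵇ : ∀ {x y} → x ≡ y → T (x ≈ᵇ y)
  ≡⇒≈ᵇ {x} refl = from T-∧ (≤-refl x , ≤-refl x)

  unique-deduplicate : ∀ xs → Unique (deduplicateᵇ _≈ᵇ_ xs)
  unique-deduplicate []       = []
  unique-deduplicate (x ∷ xs) =
    All.map (λ x≉y x≡y → x≉y (≡⇒≈ᵇ x≡y)) (all-filter _ (deduplicateᵇ _≈ᵇ_ xs))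
    ∷ Unique.filter⁺ _ (unique-deduplicate xs)

  ∈-deduplicate⁺ : ∀ {xs z} → z ∈ xs → z ∈ deduplicateᵇ _≈ᵇ_ xs
  ∈-deduplicate⁺ = SetoidMembership.∈-deduplicate⁺ (setoid Carrier) (λ x y → T? (x ≈ᵇ y))
                     (λ x≈y z≡y → trans z≡y (sym (≈ᵇ⇒≡ x≈y)))

  elements : Enumeration Carrier
  elements = record
    { list     = deduplicateᵇ _≈ᵇ_ elems
    ; unique   = unique-deduplicate elems
    ; complete = λ x → ∈-deduplicate⁺ (elems-complete x)
    }

  countIn-enumeration : (E : Enumeration Carrier) → ∀ x y p →
                        countIn x y p ≡ length (filterᵇ (λ z → x ≤ᵇ z ∧ (z ≤ᵇ y ∧ p z)) (list E))
  countIn-enumeration E x y p =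
    ↭-length (∼bag⇒↭ (unique∧set⇒bag (unique-deduplicate _) (Unique.filter⁺ (T? ∘ C) (unique E))
                                      (λ {z} → mk⇔ ⊆E E⊆)))
    where
    C : Carrier → Bool
    C z = x ≤ᵇ z ∧ (z ≤ᵇ y ∧ p z)
    ⊆E : ∀ {z} → z ∈ deduplicateᵇ _≈ᵇ_ (filterᵇ C elems) → z ∈ filterᵇ C (list E)
    ⊆E z∈ = ∈-filter⁺ (T? ∘ C) (complete E _)
                      (proj₂ (∈-filter⁻ (T? ∘ C) {xs = elems} (∈-deduplicate⁻ _ _ z∈)))
    E⊆ : ∀ {z} → z ∈ filterᵇ C (list E) → z ∈ deduplicateᵇ _≈ᵇ_ (filterᵇ C elems)
    E⊆ z∈ = ∈-deduplicate⁺ (∈-filter⁺ (T? ∘ C) (elems-complete _)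
                                      (proj₂ (∈-filter⁻ (T? ∘ C) {xs = list E} z∈)))

  Balanced : (Carrier → ℕ) → Carrier → Carrier → Set
  Balanced r x y = countIn x y (λ z → isEven (r z)) ≡ countIn x y (λ z → not (isEven (r z)))

  signedCount : (E : Enumeration Carrier) (r : Carrier → ℕ) → ∀ x y →
    ℤ.+ countIn x y (λ z → isEven (r z)) - ℤ.+ countIn x y (λ z → not (isEven (r z)))
      ≡ ∑[ z ∈ list E ] ⟦ x ≤ᵇ z ∧ z ≤ᵇ y ⟧ * -1ℤ ^ r z
  signedCount E r x y = begin
    ℤ.+ countIn x y (C isEven) - ℤ.+ countIn x y (C odd)
      ≡⟨ cong₂ (λ m n → ℤ.+ m - ℤ.+ n) (countIn-enumeration E x y _) (countIn-enumeration E x y _) ⟩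
    ℤ.+ length (filterᵇ (between (C isEven)) L) - ℤ.+ length (filterᵇ (between (C odd)) L)
      ≡⟨ cong₂ _-_ (length-filterᵇ _ L) (length-filterᵇ _ L) ⟩
    (∑[ z ∈ L ] ⟦ between (C isEven) z ⟧) - (∑[ z ∈ L ] ⟦ between (C odd) z ⟧)
      ≡⟨ sym (∑-- L) ⟩
    ∑[ z ∈ L ] (⟦ between (C isEven) z ⟧ - ⟦ between (C odd) z ⟧)
      ≡⟨ ∑-cong L parity ⟩
    ∑[ z ∈ L ] ⟦ x ≤ᵇ z ∧ z ≤ᵇ y ⟧ * -1ℤ ^ r z  ∎
    where
    open ≡-Reasoning
    L : List Carrier
    L = list E
    odd : ℕ → Bool
    odd k = not (isEven k)
    C : (ℕ → Bool) → Carrier → Bool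
    C p z = p (r z)
    between : (Carrier → Bool) → Carrier → Bool
    between p z = x ≤ᵇ z ∧ (z ≤ᵇ y ∧ p z)
    parity : ∀ z → ⟦ between (C isEven) z ⟧ - ⟦ between (C odd) z ⟧ ≡ ⟦ x ≤ᵇ z ∧ z ≤ᵇ y ⟧ * -1ℤ ^ r z
    parity z = trans (cong₂ (λ a b → ⟦ a ⟧ - ⟦ b ⟧) (sym (∧-assoc (x ≤ᵇ z) (z ≤ᵇ y) _))
                                                    (sym (∧-assoc (x ≤ᵇ z) (z ≤ᵇ y) _)))
                     (⟦⟧-parity (x ≤ᵇ z ∧ z ≤ᵇ y) (r z))

  balanced⇒∑≡0 : (E : Enumeration Carrier) (r : Carrier → ℕ) → ∀ {x y} → Balanced r x y →
                 ∑[ z ∈ list E ] ⟦ x ≤ᵇ z ∧ z ≤ᵇ y ⟧ * -1ℤ ^ r z ≡ 0ℤ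
  balanced⇒∑≡0 E r {x} {y} balanced = trans (sym (signedCount E r x y)) (ℤₚ.i≡j⇒i-j≡0 (cong ℤ.+_ balanced))

  ∑≡0⇒balanced : (E : Enumeration Carrier) (r : Carrier → ℕ) → ∀ {x y} →
                 ∑[ z ∈ list E ] ⟦ x ≤ᵇ z ∧ z ≤ᵇ y ⟧ * -1ℤ ^ r z ≡ 0ℤ → Balanced r x y
  ∑≡0⇒balanced E r {x} {y} ∑≡0 = ℤₚ.+-injective (ℤₚ.i-j≡0⇒i≡j _ _ (trans (signedCount E r x y) ∑≡0))

  chain-head-< : ∀ {a l} → Chain (a ∷ l) → All (a <_) l
  chain-head-< chain with Linked⇒AllPairs <-trans chain
  ... | a<l ∷ᴬ _ = a<l

  infix 4 _⋖_
  _⋖_ : Carrier → Carrier → Set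
  x ⋖ y = x < y × (∀ w → x ≤ w → w ≤ y → w ≡ x ⊎ w ≡ y)

  infixr 5 _◅_
  data SatChain : Carrier → Carrier → List Carrier → Set where
    [_] : ∀ x → SatChain x x (x ∷ [])
    _◅_ : ∀ {x y z l} → x ⋖ y → SatChain y z l → SatChain x z (x ∷ l)

  Saturated : Carrier → Carrier → List Carrier → Set
  Saturated x z l = ∀ w → x ≤ w → w ≤ z → (∀ e → e ∈ l → Comparable w e) → w ∈ l

  SatChain-head : ∀ {x z l} → SatChain x z l → x ∈ l
  SatChain-head [ x ]   = here refl
  SatChain-head (_ ◅ _) = here refl

  SatChain-≤ : ∀ {x z l} → SatChain x z l → x ≤ z
  SatChain-≤ [ x ]                        = ≤-refl x
  SatChain-≤ {x} {z} (_◅_ {y = y} x⋖y c) = ≤-trans x y z (proj₁ (proj₁ x⋖y)) (SatChain-≤ c)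

  SatChain-chain : ∀ {x z l} → SatChain x z l → Chain l
  SatChain-chain [ x ]               = [-]
  SatChain-chain (x⋖y ◅ [ y ])       = proj₁ x⋖y ∷ [-]
  SatChain-chain (x⋖y ◅ c@(_ ◅ _))  = proj₁ x⋖y ∷ SatChain-chain c

  SatChain-bounded : ∀ {x z l} → SatChain x z l → All (_≤ z) l
  SatChain-bounded [ x ]          = ≤-refl x ∷ []
  SatChain-bounded c@(_ ◅ rest) = SatChain-≤ c ∷ SatChain-bounded rest

  SatChain-saturated : ∀ {x z l} → SatChain x z l → Saturated x z l
  SatChain-saturated [ x ] w x≤w w≤x _ = here (≤-antisym w x w≤x x≤w)
  SatChain-saturated (_◅_ {y = y} (_ , x⋖y) c) w x≤w w≤z comparable
    with comparable y (there (SatChain-head c))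
  ... | inj₂ y≤w = there (SatChain-saturated c w y≤w w≤z (λ e → comparable e ∘ there))
  ... | inj₁ w≤y with x⋖y w x≤w w≤y
  ...   | inj₁ w≡x = here w≡x
  ...   | inj₂ w≡y = there (subst (_∈ _) (sym w≡y) (SatChain-head c))

  SatChain-∷ʳ : ∀ {x y z l} → SatChain x y l → y ⋖ z → SatChain x z (l ∷ʳ z)
  SatChain-∷ʳ [ x ]       x⋖z = x⋖z ◅ [ _ ]
  SatChain-∷ʳ (x⋖y ◅ c) y⋖z = x⋖y ◅ SatChain-∷ʳ c y⋖z

  saturated⇒SatChain : ∀ {a l z} → Chain (a ∷ l) → All (_≤ z) (a ∷ l) → Saturated a z (a ∷ l) →
                       SatChain a z (a ∷ l)
  saturated⇒SatChain {a} {[]} {z} _ (a≤z ∷ []) saturated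
    with saturated z a≤z (≤-refl z) (λ { _ (here refl) → inj₂ a≤z })
  ... | here refl = [ a ]
  saturated⇒SatChain {a} {a′ ∷ l} {z} (a<a′ ∷ chain) (_ ∷ bounded) saturated =
    a⋖a′ ◅ saturated⇒SatChain chain bounded saturated′
    where
    a′<l : All (a′ <_) l
    a′<l = chain-head-< chain
    a⋖a′ : a ⋖ a′
    a⋖a′ = a<a′ , λ w a≤w w≤a′ →
      inside w a≤w w≤a′ (saturated w a≤w (≤-trans w a′ z w≤a′ (All.head bounded)) (comparable w a≤w w≤a′))
      where
      comparable : ∀ w → a ≤ w → w ≤ a′ → ∀ e → e ∈ a ∷ a′ ∷ l → Comparable w e
      comparable w a≤w w≤a′ _ (here refl)          = inj₂ a≤w
      comparable w a≤w w≤a′ _ (there (here refl))  = inj₁ w≤a′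
      comparable w a≤w w≤a′ e (there (there e∈l)) = inj₁ (≤-trans w a′ e w≤a′ (proj₁ (All.lookup a′<l e∈l)))
      inside : ∀ w → a ≤ w → w ≤ a′ → w ∈ a ∷ a′ ∷ l → w ≡ a ⊎ w ≡ a′
      inside w _ _    (here w≡a)           = inj₁ w≡a
      inside w _ _    (there (here w≡a′))  = inj₂ w≡a′
      inside w _ w≤a′ (there (there w∈l)) = contradiction w≤a′ (<⇒≱ (All.lookup a′<l w∈l))
    saturated′ : Saturated a′ z (a′ ∷ l)
    saturated′ w a′≤w w≤z comparable =
      drop-a (saturated w a≤w w≤z (λ { _ (here refl) → inj₂ a≤w ; e (there e∈) → comparable e e∈ }))
      where
      a≤w : a ≤ w
      a≤w = ≤-trans a a′ w (proj₁ a<a′) a′≤w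
      drop-a : w ∈ a ∷ a′ ∷ l → w ∈ a′ ∷ l
      drop-a (here refl) = contradiction a′≤w (<⇒≱ a<a′)
      drop-a (there w∈)  = w∈

  SatChain-length : (r : Carrier → ℕ) → (∀ {x y} → x ⋖ y → r y ≡ suc (r x)) →
                    ∀ {x z l} → SatChain x z l → length l ℕ.+ r x ≡ suc (r z)
  SatChain-length r r-cover [ x ]                = refl
  SatChain-length r r-cover {x} {l = _ ∷ l} (x⋖y ◅ c) =
    trans (sym (ℕₚ.+-suc (length l) (r x)))
          (trans (cong (length l ℕ.+_) (sym (r-cover x⋖y))) (SatChain-length r r-cover c))

  module _ {S : Pred Carrier 0ℓ} (S? : Decidable S) where

    -- The candidate only ever decreases, so an element rejected against an earlier candidate
    -- is not below the final one either.
    private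
      scan : Carrier → List Carrier → Carrier
      scan m []       = m
      scan m (e ∷ es) with S? e ×-dec (e <? m)
      ... | yes _ = scan e es
      ... | no  _ = scan m es

      scan-S : ∀ {m} es → S m → S (scan m es)
      scan-S []             Sm = Sm
      scan-S {m} (e ∷ es) Sm with S? e ×-dec (e <? m)
      ... | yes (Se , _) = scan-S es Se
      ... | no  _        = scan-S es Sm

      scan-≤ : ∀ m es → scan m es ≤ m
      scan-≤ m []       = ≤-refl m
      scan-≤ m (e ∷ es) with S? e ×-dec (e <? m)
      ... | yes (_ , e<m) = ≤-trans _ e m (scan-≤ e es) (proj₁ e<m)
      ... | no  _         = scan-≤ m es

      scan-minimal : ∀ m es {e} → e ∈ es → S e → ¬ e < scan m es
      scan-minimal m (e ∷ es) e∈ Se with S? e ×-dec (e <? m) | e∈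
      ... | yes _        | here refl   = λ e<scan → <⇒≱ e<scan (scan-≤ e es)
      ... | yes _        | there e∈es = scan-minimal _ es e∈es Se
      ... | no ¬[Se,e<m] | here refl   = λ e<scan → ¬[Se,e<m] (Se , <-≤-trans e<scan (scan-≤ m es))
      ... | no _         | there e∈es = scan-minimal m es e∈es Se

    minimal-below : ∀ {a} → S a → ∃[ m ] (S m × m ≤ a × ∀ {e} → S e → ¬ e < m)
    minimal-below {a} Sa =
      scan a elems , scan-S elems Sa , scan-≤ a elems , λ {e} → scan-minimal a elems (elems-complete e)

  ⋖-towards : ∀ {x y} → x < y → ∃[ w ] (x ⋖ w × w ≤ y)
  ⋖-towards {x} {y} x<y with minimal-below (λ e → (x <? e) ×-dec (e ≤? y)) (x<y , ≤-refl y)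
  ... | w , (x<w , w≤y) , _ , w-minimal = w , (x<w , x-or-w) , w≤y
    where
    x-or-w : ∀ v → x ≤ v → v ≤ w → v ≡ x ⊎ v ≡ w
    x-or-w v x≤v v≤w with v ≟ x | v ≟ w
    ... | yes v≡x | _       = inj₁ v≡x
    ... | no _    | yes v≡w = inj₂ v≡w
    ... | no v≢x  | no v≢w  = contradiction (v≤w , v≢w)
                                (w-minimal ((x≤v , v≢x ∘ sym) , ≤-trans v w y v≤w w≤y))

  SatChain-exists : ∀ {x y} → x ≤ y → ∃ (SatChain x y)
  SatChain-exists {x} {y} x≤y = climb (suc (height x)) x≤y ℕₚ.≤-refl
    where
    between? : ∀ m → Decidable (λ e → m < e × e ≤ y)
    between? m e = (m <? e) ×-dec (e ≤? y)
    height : Carrier → ℕ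
    height m = length (filter (between? m) elems)
    climb : ∀ k {m} → m ≤ y → height m ℕ.< k → ∃ (SatChain m y)
    climb (suc k) {m} m≤y h<k with m ≟ y
    ... | yes refl = _ , [ m ]
    ... | no m≢y with ⋖-towards (m≤y , m≢y)
    ...   | w , m⋖w , w≤y = _ , m⋖w ◅ proj₂ (climb k w≤y (ℕₚ.<-≤-trans height-drops (ℕₚ.≤-pred h<k)))
      where
      height-drops : height w ℕ.< height m
      height-drops = length-filter-strict (between? w) (between? m)
                       (λ (w<e , e≤y) → <-trans (proj₁ m⋖w) w<e , e≤y)
                       (elems-complete w) (proj₁ m⋖w , w≤y) (λ (w<w , _) → proj₂ w<w refl)

  module WithBottom {0̂ : Carrier} (0̂-min : ∀ x → 0̂ ≤ x) where

    SatChain⇒maximal : ∀ {z l} → SatChain 0̂ z l → MaximalChainIn (_≤ z) l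
    SatChain⇒maximal c =
      SatChain-chain c , SatChain-bounded c , λ w w≤z → SatChain-saturated c w (0̂-min w) w≤z

    maximal⇒SatChain : ∀ {z l} → MaximalChainIn (_≤ z) l → SatChain 0̂ z l
    maximal⇒SatChain {z} {[]} (_ , _ , maximal) with maximal 0̂ (0̂-min z) (λ w _ → inj₁ (0̂-min w))
    ... | ()
    maximal⇒SatChain {z} {a ∷ _} (chain , bounded , maximal)
      with maximal 0̂ (0̂-min z) (λ w _ → inj₁ (0̂-min w))
    ... | here refl  = saturated⇒SatChain chain bounded (λ w _ → maximal w)
    ... | there 0̂∈ = contradiction (0̂-min a) (<⇒≱ (All.lookup (chain-head-< chain) 0̂∈))

    isRank-from-covers : (r : Carrier → ℕ) → r 0̂ ≡ 0 → (∀ {x y} → x ⋖ y → r y ≡ suc (r x)) → IsRank r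
    isRank-from-covers r r0̂≡0 r-cover z l maximal = begin
      length l                ≡⟨ sym (ℕₚ.+-identityʳ (length l)) ⟩
      length l ℕ.+ 0          ≡⟨ cong (length l ℕ.+_) (sym r0̂≡0) ⟩
      length l ℕ.+ r 0̂        ≡⟨ SatChain-length r r-cover (maximal⇒SatChain maximal) ⟩
      suc (r z)               ∎
      where open ≡-Reasoning

    module Ranked {ρ : Carrier → ℕ} (isRank : IsRank ρ) where

      SatChain-rank : ∀ {z l} → SatChain 0̂ z l → length l ≡ suc (ρ z)
      SatChain-rank c = isRank _ _ (SatChain⇒maximal c)

      ρ-0̂ : ρ 0̂ ≡ 0
      ρ-0̂ = ℕₚ.suc-injective (sym (SatChain-rank [ 0̂ ]))

      ρ-cover : ∀ {x y} → x ⋖ y → ρ y ≡ suc (ρ x)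
      ρ-cover {x} {y} x⋖y with SatChain-exists (0̂-min x)
      ... | l , c = ℕₚ.suc-injective (begin
        suc (ρ y)            ≡⟨ sym (SatChain-rank (SatChain-∷ʳ c x⋖y)) ⟩
        length (l ∷ʳ y)      ≡⟨ trans (length-++ l) (ℕₚ.+-comm (length l) 1) ⟩
        suc (length l)       ≡⟨ cong suc (SatChain-rank c) ⟩
        suc (suc (ρ x))      ∎)
        where open ≡-Reasoning

      ρ-mono : ∀ {x y} → x ≤ y → ρ x ℕ.≤ ρ y
      ρ-mono x≤y = along (proj₂ (SatChain-exists x≤y))
        where
        along : ∀ {x y l} → SatChain x y l → ρ x ℕ.≤ ρ y
        along [ x ]                      = ℕₚ.≤-refl
        along {x} {z} (x⋖y ◅ c) =
          ℕₚ.≤-trans (ℕₚ.n≤1+n (ρ x)) (subst (ℕ._≤ ρ z) (ρ-cover x⋖y) (along c))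

-- The Bier poset of an Eulerian poset

module BierEulerian (P : FinPoset) (I : FinPoset.Carrier P → Bool) (ideal : IsIdeal P I) where
  open FinPoset P
  open FinPosetProperties P

  module B = FinPoset (Bier P I)
  module Bᴾ = FinPosetProperties (Bier P I)

  private
    variable
      u v u′ v′ : Carrier

  pattern 1̂ᴮ = nothing
  pattern interval u v p = just ((u , v) , p)

  -- Equality on B.Carrier, which pins down the type of the interval patterns.
  infix 4 _≡ᴮ_
  _≡ᴮ_ : B.Carrier → B.Carrier → Set
  _≡ᴮ_ = _≡_

  interval-injective : ∀ {p : T (bierCond P I u v)} {p′ : T (bierCond P I u′ v′)} →
                       interval u v p ≡ᴮ interval u′ v′ p′ → u ≡ u′ × v ≡ v′
  interval-injective refl = refl , refl

  interval-≡ : (q q′ : T (bierCond P I u v)) → interval u v q ≡ᴮ interval u v q′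
  interval-≡ q q′ = cong (interval _ _) (T-irrelevant q q′)

  interval-≤ : u ≤ u′ → v′ ≤ v → T (u ≤ᵇ u′ ∧ v′ ≤ᵇ v)
  interval-≤ u≤u′ v′≤v = from T-∧ (u≤u′ , v′≤v)

  bier-intro : T (I u) → ¬ T (I v) → u ≤ v → T (bierCond P I u v)
  bier-intro Iu ¬Iv u≤v = from T-∧ (Iu , from T-∧ (from T-not ¬Iv , u≤v))

  bier-elim : T (bierCond P I u v) → T (I u) × ¬ T (I v) × u ≤ v
  bier-elim p = let (Iu , q) = to T-∧ p ; (¬Iv , u≤v) = to T-∧ q in Iu , to T-not ¬Iv , u≤v

  bier-widen : T (bierCond P I u′ v′) → u ≤ u′ → v′ ≤ v → T (bierCond P I u v)
  bier-widen {u′} {v′} {u} {v} p′ u≤u′ v′≤v with bier-elim p′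
  ... | Iu′ , ¬Iv′ , u′≤v′ =
    bier-intro (ideal u u′ u≤u′ Iu′) (λ Iv → ¬Iv′ (ideal v′ v v′≤v Iv))
               (≤-trans u u′ v u≤u′ (≤-trans u′ v′ v u′≤v′ v′≤v))

  ⟦bier⟧≡difference : ∀ u v → ⟦ bierCond P I u v ⟧ ≡ ⟦ I u ⟧ * ⟦ u ≤ᵇ v ⟧ - ⟦ I v ⟧ * ⟦ u ≤ᵇ v ⟧
  ⟦bier⟧≡difference u v = begin
    ⟦ I u ∧ (not (I v) ∧ u ≤ᵇ v) ⟧
      ≡⟨ trans (⟦⟧-∧ (I u) _)
               (cong (⟦ I u ⟧ *_) (trans (⟦⟧-∧ (not (I v)) _) (cong (_* ⟦ u ≤ᵇ v ⟧) (⟦⟧-not (I v))))) ⟩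
    ⟦ I u ⟧ * ((1ℤ - ⟦ I v ⟧) * ⟦ u ≤ᵇ v ⟧)
      ≡⟨ expand ⟦ I u ⟧ ⟦ I v ⟧ ⟦ u ≤ᵇ v ⟧ ⟩
    ⟦ I u ⟧ * ⟦ u ≤ᵇ v ⟧ - ⟦ I u ⟧ * (⟦ I v ⟧ * ⟦ u ≤ᵇ v ⟧)
      ≡⟨ cong ((⟦ I u ⟧ * ⟦ u ≤ᵇ v ⟧) -_) absorb ⟩
    ⟦ I u ⟧ * ⟦ u ≤ᵇ v ⟧ - ⟦ I v ⟧ * ⟦ u ≤ᵇ v ⟧  ∎
    where
    open ≡-Reasoning
    expand : ∀ a b c → a * ((1ℤ - b) * c) ≡ a * c - a * (b * c)
    expand = solve-∀
    absorb : ⟦ I u ⟧ * (⟦ I v ⟧ * ⟦ u ≤ᵇ v ⟧) ≡ ⟦ I v ⟧ * ⟦ u ≤ᵇ v ⟧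
    absorb = begin
      ⟦ I u ⟧ * (⟦ I v ⟧ * ⟦ u ≤ᵇ v ⟧)  ≡⟨ cong (⟦ I u ⟧ *_) (sym (⟦⟧-∧ (I v) _)) ⟩
      ⟦ I u ⟧ * ⟦ I v ∧ u ≤ᵇ v ⟧          ≡⟨ ⟦⟧-absorbˡ (λ h → let (Iv , u≤v) = to T-∧ h in ideal _ _ u≤v Iv) ⟩
      ⟦ I v ∧ u ≤ᵇ v ⟧                    ≡⟨ ⟦⟧-∧ (I v) _ ⟩
      ⟦ I v ⟧ * ⟦ u ≤ᵇ v ⟧                ∎

  L : List Carrier
  L = list elements

  elementsᴮ : Enumeration B.Carrier
  elementsᴮ =
    enumerateMaybe (enumerateΣ (λ uv → bierCond P I (proj₁ uv) (proj₂ uv)) (enumerate× elements elements))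

  ∑-elementsᴮ : (g : B.Carrier → ℤ) (G : Carrier → Carrier → ℤ) → (∀ u v p → g (interval u v p) ≡ G u v) →
       ∑ (list elementsᴮ) g ≡ g 1̂ᴮ + (∑[ u ∈ L ] ∑[ v ∈ L ] ⟦ bierCond P I u v ⟧ * G u v)
  ∑-elementsᴮ g G g≗G = cong (g 1̂ᴮ +_) (begin
    ∑ (map just (mapMaybe (restrict c) (cartesianProduct L L))) g
      ≡⟨ ∑-map (mapMaybe (restrict c) (cartesianProduct L L)) just g ⟩
    ∑ (mapMaybe (restrict c) (cartesianProduct L L)) (g ∘ just)
      ≡⟨ ∑-restrict c (cartesianProduct L L) (λ (u , v) → g≗G u v) ⟩
    ∑[ uv ∈ cartesianProduct L L ] ⟦ c uv ⟧ * G (proj₁ uv) (proj₂ uv)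
      ≡⟨ ∑-cartesianProduct L L _ ⟩
    ∑[ u ∈ L ] ∑[ v ∈ L ] ⟦ bierCond P I u v ⟧ * G u v  ∎)
    where
    open ≡-Reasoning
    c : Carrier × Carrier → Bool
    c uv = bierCond P I (proj₁ uv) (proj₂ uv)

  module _ {0̂ 1̂ : Carrier} (0̂-min : ∀ x → 0̂ ≤ x) (1̂-max : ∀ x → x ≤ 1̂)
           {ρ : Carrier → ℕ} (isRank : IsRank ρ) (balanced : ∀ x y → x < y → Balanced ρ x y)
           (0̂∈I : T (I 0̂)) (1̂∉I : ¬ T (I 1̂)) where

    open WithBottom 0̂-min
    open Ranked isRank

    n : ℕ
    n = ρ 1̂

    ρ≤n : ∀ v → ρ v ℕ.≤ n
    ρ≤n v = ρ-mono (1̂-max v)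

    corank : Carrier → ℕ
    corank v = n ℕ.∸ ρ v

    corank-cover : v′ ⋖ v → corank v′ ≡ suc (corank v)
    corank-cover {v′} {v} v′⋖v = begin
      n ℕ.∸ ρ v′               ≡⟨ ℕₚ.+-∸-assoc 1 (subst (ℕ._≤ n) (ρ-cover v′⋖v) (ρ≤n v)) ⟩
      suc (n ℕ.∸ suc (ρ v′))   ≡⟨ cong (λ k → suc (n ℕ.∸ k)) (sym (ρ-cover v′⋖v)) ⟩
      suc (n ℕ.∸ ρ v)          ∎
      where open ≡-Reasoning

    ρᴮ : B.Carrier → ℕ
    ρᴮ 1̂ᴮ                = n
    ρᴮ (interval u v _) = ρ u ℕ.+ corank v

    0̂ᴮ : B.Carrier
    0̂ᴮ = interval 0̂ 1̂ (bier-intro 0̂∈I 1̂∉I (0̂-min 1̂))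

    0̂ᴮ-min : ∀ α → 0̂ᴮ B.≤ α
    0̂ᴮ-min 1̂ᴮ                = tt
    0̂ᴮ-min (interval u v _) = interval-≤ (0̂-min u) (1̂-max v)

    ρᴮ-0̂ᴮ : ρᴮ 0̂ᴮ ≡ 0
    ρᴮ-0̂ᴮ = cong₂ ℕ._+_ ρ-0̂ (ℕₚ.n∸n≡0 n)

    interval-⋖-1̂ : ∀ {p : T (bierCond P I u v)} → interval u v p Bᴾ.⋖ 1̂ᴮ → u ⋖ v
    interval-⋖-1̂ {u} {v} {p} (_ , between) with bier-elim p
    ... | Iu , ¬Iv , u≤v = (u≤v , λ { refl → ¬Iv Iu }) , lower-or-upper
      where
      lower-or-upper : ∀ w → u ≤ w → w ≤ v → w ≡ u ⊎ w ≡ v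
      lower-or-upper w u≤w w≤v with T? (I w)
      ... | yes Iw with between (interval w v (bier-intro Iw ¬Iv w≤v)) (interval-≤ u≤w (≤-refl v)) tt
      ...   | inj₁ eq = inj₁ (proj₁ (interval-injective eq))
      lower-or-upper w u≤w w≤v | no ¬Iw
        with between (interval u w (bier-intro Iu ¬Iw u≤w)) (interval-≤ (≤-refl u) w≤v) tt
      ...   | inj₁ eq = inj₂ (proj₂ (interval-injective eq))

    ⋖ᴮ-fixes-an-end : ∀ {p : T (bierCond P I u v)} {p′ : T (bierCond P I u′ v′)} →
                      interval u v p Bᴾ.⋖ interval u′ v′ p′ → u ≡ u′ ⊎ v ≡ v′
    ⋖ᴮ-fixes-an-end {u} {v} {u′} {v′} {p} {p′} ((α≤β , _) , between) with u ≟ u′ | to T-∧ α≤β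
    ... | yes u≡u′ | _           = inj₁ u≡u′
    ... | no u≢u′  | u≤u′ , v′≤v =
      inj₂ ([ (λ eq → contradiction (sym (proj₁ (interval-injective eq))) u≢u′)
            , (λ eq → proj₂ (interval-injective eq)) ]′
            (between (interval u′ v (bier-widen p′ (≤-refl u′) v′≤v))
                     (interval-≤ u≤u′ (≤-refl v)) (interval-≤ (≤-refl u′) v′≤v)))

    ⋖ᴮ-same-lower : ∀ {p : T (bierCond P I u v)} {p′ : T (bierCond P I u v′)} →
                    interval u v p Bᴾ.⋖ interval u v′ p′ → v′ ⋖ v
    ⋖ᴮ-same-lower {u} {v} {v′} {p} {p′} ((α≤β , α≢β) , between) =
      (v′≤v , λ { refl → α≢β (interval-≡ p p′) }) , upper-or-lower
      where
      v′≤v : v′ ≤ v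
      v′≤v = proj₂ (to T-∧ α≤β)
      upper-or-lower : ∀ w → v′ ≤ w → w ≤ v → w ≡ v′ ⊎ w ≡ v
      upper-or-lower w v′≤w w≤v =
        Sum.swap (Sum.map (proj₂ ∘ interval-injective) (proj₂ ∘ interval-injective)
          (between (interval u w (bier-widen p′ (≤-refl u) v′≤w))
                   (interval-≤ (≤-refl u) w≤v) (interval-≤ (≤-refl u) v′≤w)))

    ⋖ᴮ-same-upper : ∀ {p : T (bierCond P I u v)} {p′ : T (bierCond P I u′ v)} →
                    interval u v p Bᴾ.⋖ interval u′ v p′ → u ⋖ u′
    ⋖ᴮ-same-upper {u} {v} {u′} {p} {p′} ((α≤β , α≢β) , between) =
      (u≤u′ , λ { refl → α≢β (interval-≡ p p′) }) , lower-or-upper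
      where
      u≤u′ : u ≤ u′
      u≤u′ = proj₁ (to T-∧ α≤β)
      lower-or-upper : ∀ w → u ≤ w → w ≤ u′ → w ≡ u ⊎ w ≡ u′
      lower-or-upper w u≤w w≤u′ =
        Sum.map (proj₁ ∘ interval-injective) (proj₁ ∘ interval-injective)
          (between (interval w v (bier-widen p′ w≤u′ (≤-refl v)))
                   (interval-≤ u≤w (≤-refl v)) (interval-≤ w≤u′ (≤-refl v)))

    ρᴮ-cover : ∀ {α β} → α Bᴾ.⋖ β → ρᴮ β ≡ suc (ρᴮ α)
    ρᴮ-cover {1̂ᴮ}             {1̂ᴮ}               ((_ , α≢β) , _) = contradiction refl α≢β
    ρᴮ-cover {interval u v p} {1̂ᴮ}               α⋖1̂ᴮ = begin
      n                         ≡⟨ sym (ℕₚ.m+[n∸m]≡n (ρ≤n v)) ⟩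
      ρ v ℕ.+ corank v          ≡⟨ cong (ℕ._+ corank v) (ρ-cover (interval-⋖-1̂ α⋖1̂ᴮ)) ⟩
      suc (ρ u) ℕ.+ corank v    ∎
      where open ≡-Reasoning
    ρᴮ-cover {interval u v p} {interval u′ v′ p′} α⋖β with ⋖ᴮ-fixes-an-end α⋖β
    ... | inj₁ refl = trans (cong (ρ u ℕ.+_) (corank-cover (⋖ᴮ-same-lower α⋖β))) (ℕₚ.+-suc (ρ u) (corank v))
    ... | inj₂ refl = cong (ℕ._+ corank v) (ρ-cover (⋖ᴮ-same-upper α⋖β))

    ρᴮ-isRank : B.IsRank ρᴮ
    ρᴮ-isRank = Bᴾ.WithBottom.isRank-from-covers 0̂ᴮ-min ρᴮ ρᴮ-0̂ᴮ ρᴮ-cover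

    sgn : Carrier → ℤ
    sgn z = -1ℤ ^ ρ z

    intervalSum : Carrier → Carrier → ℤ
    intervalSum x y = ∑[ z ∈ L ] ⟦ x ≤ᵇ z ∧ z ≤ᵇ y ⟧ * sgn z

    intervalSum-refl : ∀ x → intervalSum x x ≡ sgn x
    intervalSum-refl x =
      trans (∑-unique-support (unique elements) (complete elements x) outside)
            (⟦⟧*-true (from T-∧ (≤-refl x , ≤-refl x)) (sgn x))
      where
      outside : ∀ z → z ≢ x → ⟦ x ≤ᵇ z ∧ z ≤ᵇ x ⟧ * sgn z ≡ 0ℤ
      outside z z≢x = ⟦⟧*-vanish (sgn z) (λ h → let (x≤z , z≤x) = to T-∧ h in
                                             contradiction (≤-antisym z x z≤x x≤z) z≢x)

    intervalSum-≢ : ∀ {x y} → x ≢ y → intervalSum x y ≡ 0ℤ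
    intervalSum-≢ {x} {y} x≢y with x ≤? y
    ... | yes x≤y = balanced⇒∑≡0 elements ρ (balanced x y (x≤y , x≢y))
    ... | no x≰y  = ∑-zero (All.tabulate {xs = L} λ {z} _ →
                      ⟦⟧*-vanish (sgn z) (λ h → let (x≤z , z≤y) = to T-∧ h in
                                                contradiction (≤-trans x z y x≤z z≤y) x≰y))

    sgn-ρᴮ : ∀ u v → -1ℤ ^ (ρ u ℕ.+ corank v) ≡ sgn 1̂ * (sgn u * sgn v)
    sgn-ρᴮ u v = begin
      -1ℤ ^ (ρ u ℕ.+ corank v)     ≡⟨ ℤₚ.^-distribˡ-+-* -1ℤ (ρ u) (corank v) ⟩
      sgn u * -1ℤ ^ corank v        ≡⟨ cong (sgn u *_) (-1^-∸ (ρ≤n v)) ⟩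
      sgn u * (sgn v * sgn 1̂)       ≡⟨ rotate (sgn u) (sgn v) (sgn 1̂) ⟩
      sgn 1̂ * (sgn u * sgn v)       ∎
      where
      open ≡-Reasoning
      rotate : ∀ a b c → a * (b * c) ≡ c * (a * b)
      rotate = solve-∀

    weightᴮ : B.Carrier → B.Carrier → B.Carrier → ℤ
    weightᴮ α β γ = ⟦ α B.≤ᵇ γ ∧ γ B.≤ᵇ β ⟧ * -1ℤ ^ ρᴮ γ

    intervalSumᴮ : B.Carrier → B.Carrier → ℤ
    intervalSumᴮ α β = ∑ (list elementsᴮ) (weightᴮ α β)

    module _ {x y x′ y′ : Carrier} where

      interval-weight-factorises : T (bierCond P I x′ y′) → ∀ u v →
        ⟦ bierCond P I u v ⟧ * (⟦ (x ≤ᵇ u ∧ v ≤ᵇ y) ∧ (u ≤ᵇ x′ ∧ y′ ≤ᵇ v) ⟧ * -1ℤ ^ (ρ u ℕ.+ corank v))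
          ≡ sgn 1̂ * ((⟦ x ≤ᵇ u ∧ u ≤ᵇ x′ ⟧ * sgn u) * (⟦ y′ ≤ᵇ v ∧ v ≤ᵇ y ⟧ * sgn v))
      interval-weight-factorises p′ u v = begin
        ⟦ bierCond P I u v ⟧ * (⟦ (a ∧ b) ∧ (c ∧ d) ⟧ * s)
          ≡⟨ sym (ℤₚ.*-assoc ⟦ bierCond P I u v ⟧ _ s) ⟩
        ⟦ bierCond P I u v ⟧ * ⟦ (a ∧ b) ∧ (c ∧ d) ⟧ * s
          ≡⟨ cong (_* s) (⟦⟧-absorbˡ inside⇒bier) ⟩
        ⟦ (a ∧ b) ∧ (c ∧ d) ⟧ * s
          ≡⟨ cong₂ _*_ (trans (⟦⟧-∧ (a ∧ b) (c ∧ d)) (cong₂ _*_ (⟦⟧-∧ a b) (⟦⟧-∧ c d))) (sgn-ρᴮ u v) ⟩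
        (⟦ a ⟧ * ⟦ b ⟧) * (⟦ c ⟧ * ⟦ d ⟧) * (sgn 1̂ * (sgn u * sgn v))
          ≡⟨ regroup ⟦ a ⟧ ⟦ b ⟧ ⟦ c ⟧ ⟦ d ⟧ (sgn 1̂) (sgn u) (sgn v) ⟩
        sgn 1̂ * ((⟦ a ⟧ * ⟦ c ⟧ * sgn u) * (⟦ d ⟧ * ⟦ b ⟧ * sgn v))
          ≡⟨ cong (sgn 1̂ *_) (sym (cong₂ _*_ (cong (_* sgn u) (⟦⟧-∧ a c)) (cong (_* sgn v) (⟦⟧-∧ d b)))) ⟩
        sgn 1̂ * ((⟦ a ∧ c ⟧ * sgn u) * (⟦ d ∧ b ⟧ * sgn v))  ∎
        where
        open ≡-Reasoning
        a b c d : Bool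
        a = x ≤ᵇ u
        b = v ≤ᵇ y
        c = u ≤ᵇ x′
        d = y′ ≤ᵇ v
        s : ℤ
        s = -1ℤ ^ (ρ u ℕ.+ corank v)
        inside⇒bier : T ((a ∧ b) ∧ (c ∧ d)) → T (bierCond P I u v)
        inside⇒bier h = let (u≤x′ , y′≤v) = to T-∧ (proj₂ (to (T-∧ {a ∧ b}) h)) in bier-widen p′ u≤x′ y′≤v
        regroup : ∀ a b c d e s t → (a * b) * (c * d) * (e * (s * t)) ≡ e * ((a * c * s) * (d * b * t))
        regroup = solve-∀

      intervalSum-product-vanishes : ∀ {p : T (bierCond P I x y)} {p′ : T (bierCond P I x′ y′)} →
        interval x y p ≢ interval x′ y′ p′ → intervalSum x x′ * intervalSum y′ y ≡ 0ℤ
      intervalSum-product-vanishes {p} {p′} α≢β with x ≟ x′ | y′ ≟ y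
      ... | no x≢x′   | _        = cong (_* intervalSum y′ y) (intervalSum-≢ x≢x′)
      ... | yes _     | no y′≢y  = trans (cong (intervalSum x x′ *_) (intervalSum-≢ y′≢y))
                                         (ℤₚ.*-zeroʳ (intervalSum x x′))
      ... | yes refl  | yes refl = contradiction (interval-≡ p p′) α≢β

      intervalSumᴮ-intervals : ∀ {p : T (bierCond P I x y)} {p′ : T (bierCond P I x′ y′)} →
                               interval x y p B.< interval x′ y′ p′ →
                               intervalSumᴮ (interval x y p) (interval x′ y′ p′) ≡ 0ℤ
      intervalSumᴮ-intervals {p} {p′} (_ , α≢β) = begin
        intervalSumᴮ (interval x y p) (interval x′ y′ p′)
          ≡⟨ ∑-elementsᴮ (weightᴮ (interval x y p) (interval x′ y′ p′)) G (λ _ _ _ → refl) ⟩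
        0ℤ + (∑[ u ∈ L ] ∑[ v ∈ L ] ⟦ bierCond P I u v ⟧ * G u v)
          ≡⟨ ℤₚ.+-identityˡ _ ⟩
        ∑[ u ∈ L ] ∑[ v ∈ L ] ⟦ bierCond P I u v ⟧ * G u v
          ≡⟨ ∑-cong L (λ u → ∑-cong L (interval-weight-factorises p′ u)) ⟩
        ∑[ u ∈ L ] ∑[ v ∈ L ] (sgn 1̂ * (F u * H v))
          ≡⟨ ∑∑-*ˡ L L (sgn 1̂) (λ u v → F u * H v) ⟩
        sgn 1̂ * (∑[ u ∈ L ] ∑[ v ∈ L ] (F u * H v))
          ≡⟨ cong (sgn 1̂ *_) (trans (∑-product L L F H) (intervalSum-product-vanishes α≢β)) ⟩
        sgn 1̂ * 0ℤ
          ≡⟨ ℤₚ.*-zeroʳ (sgn 1̂) ⟩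
        0ℤ  ∎
        where
        open ≡-Reasoning
        G : Carrier → Carrier → ℤ
        G u v = ⟦ (x ≤ᵇ u ∧ v ≤ᵇ y) ∧ (u ≤ᵇ x′ ∧ y′ ≤ᵇ v) ⟧ * -1ℤ ^ (ρ u ℕ.+ corank v)
        F H : Carrier → ℤ
        F u = ⟦ x ≤ᵇ u ∧ u ≤ᵇ x′ ⟧ * sgn u
        H v = ⟦ y′ ≤ᵇ v ∧ v ≤ᵇ y ⟧ * sgn v

    module _ (x y : Carrier) where

      lowerInIdeal upperInIdeal : Carrier → Carrier → ℤ
      lowerInIdeal u v = ⟦ I u ⟧ * (⟦ x ≤ᵇ u ⟧ * sgn u * (⟦ u ≤ᵇ v ∧ v ≤ᵇ y ⟧ * sgn v))
      upperInIdeal u v = ⟦ I v ⟧ * ⟦ v ≤ᵇ y ⟧ * sgn v * (⟦ x ≤ᵇ u ∧ u ≤ᵇ v ⟧ * sgn u)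

      top-weight-splits : ∀ u v →
        ⟦ bierCond P I u v ⟧ * (⟦ (x ≤ᵇ u ∧ v ≤ᵇ y) ∧ true ⟧ * -1ℤ ^ (ρ u ℕ.+ corank v))
          ≡ sgn 1̂ * (lowerInIdeal u v - upperInIdeal u v)
      top-weight-splits u v = begin
        ⟦ bierCond P I u v ⟧ * (⟦ (a ∧ b) ∧ true ⟧ * -1ℤ ^ (ρ u ℕ.+ corank v))
          ≡⟨ cong₂ _*_ (⟦bier⟧≡difference u v)
                       (cong₂ _*_ (trans (cong ⟦_⟧ (∧-identityʳ (a ∧ b))) (⟦⟧-∧ a b)) (sgn-ρᴮ u v)) ⟩
        (⟦ I u ⟧ * ⟦ c ⟧ - ⟦ I v ⟧ * ⟦ c ⟧) * (⟦ a ⟧ * ⟦ b ⟧ * (sgn 1̂ * (sgn u * sgn v)))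
          ≡⟨ distribute ⟦ I u ⟧ ⟦ I v ⟧ ⟦ a ⟧ ⟦ b ⟧ ⟦ c ⟧ (sgn 1̂) (sgn u) (sgn v) ⟩
        sgn 1̂ * (⟦ I u ⟧ * (⟦ a ⟧ * sgn u * (⟦ c ⟧ * ⟦ b ⟧ * sgn v))
                 - ⟦ I v ⟧ * ⟦ b ⟧ * sgn v * (⟦ a ⟧ * ⟦ c ⟧ * sgn u))
          ≡⟨ cong (sgn 1̂ *_) (cong₂ (λ s t → ⟦ I u ⟧ * (⟦ a ⟧ * sgn u * (s * sgn v))
                                                - ⟦ I v ⟧ * ⟦ b ⟧ * sgn v * (t * sgn u))
                                     (sym (⟦⟧-∧ c b)) (sym (⟦⟧-∧ a c))) ⟩
        sgn 1̂ * (lowerInIdeal u v - upperInIdeal u v)  ∎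
        where
        open ≡-Reasoning
        a b c : Bool
        a = x ≤ᵇ u
        b = v ≤ᵇ y
        c = u ≤ᵇ v
        distribute : ∀ Iu Iv a b c e s t → (Iu * c - Iv * c) * (a * b * (e * (s * t)))
                                           ≡ e * (Iu * (a * s * (c * b * t)) - Iv * b * t * (a * c * s))
        distribute = solve-∀

      ∑∑-lowerInIdeal : ¬ T (I y) → ∑[ u ∈ L ] ∑[ v ∈ L ] lowerInIdeal u v ≡ 0ℤ
      ∑∑-lowerInIdeal ¬Iy = begin
        ∑[ u ∈ L ] ∑[ v ∈ L ] lowerInIdeal u v
          ≡⟨ ∑-cong L (λ u → trans (∑-*ˡ L ⟦ I u ⟧ _) (cong (⟦ I u ⟧ *_) (∑-*ˡ L (⟦ x ≤ᵇ u ⟧ * sgn u) _))) ⟩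
        ∑[ u ∈ L ] ⟦ I u ⟧ * (⟦ x ≤ᵇ u ⟧ * sgn u * intervalSum u y)
          ≡⟨ ∑-zero (All.tabulate {xs = L} λ {u} _ → ⟦⟧*-vanish {I u} _ (λ Iu →
               trans (cong (⟦ x ≤ᵇ u ⟧ * sgn u *_) (intervalSum-≢ (λ { refl → ¬Iy Iu })))
                     (ℤₚ.*-zeroʳ (⟦ x ≤ᵇ u ⟧ * sgn u)))) ⟩
        0ℤ  ∎
        where open ≡-Reasoning

      ∑∑-upperInIdeal : T (I x) → x ≤ y → ∑[ u ∈ L ] ∑[ v ∈ L ] upperInIdeal u v ≡ 1ℤ
      ∑∑-upperInIdeal Ix x≤y = begin
        ∑[ u ∈ L ] ∑[ v ∈ L ] upperInIdeal u v
          ≡⟨ ∑-swap L L upperInIdeal ⟩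
        ∑[ v ∈ L ] ∑[ u ∈ L ] upperInIdeal u v
          ≡⟨ ∑-cong L (λ v → ∑-*ˡ L (⟦ I v ⟧ * ⟦ v ≤ᵇ y ⟧ * sgn v) _) ⟩
        ∑[ v ∈ L ] ⟦ I v ⟧ * ⟦ v ≤ᵇ y ⟧ * sgn v * intervalSum x v
          ≡⟨ ∑-unique-support (unique elements) (complete elements x) (λ v v≢x →
               trans (cong (⟦ I v ⟧ * ⟦ v ≤ᵇ y ⟧ * sgn v *_) (intervalSum-≢ (v≢x ∘ sym)))
                     (ℤₚ.*-zeroʳ (⟦ I v ⟧ * ⟦ v ≤ᵇ y ⟧ * sgn v))) ⟩
        ⟦ I x ⟧ * ⟦ x ≤ᵇ y ⟧ * sgn x * intervalSum x x
          ≡⟨ cong₂ (λ s t → s * t * sgn x * intervalSum x x) (⟦⟧-true Ix) (⟦⟧-true x≤y) ⟩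
        1ℤ * 1ℤ * sgn x * intervalSum x x
          ≡⟨ cong₂ _*_ (ℤₚ.*-identityˡ (sgn x)) (intervalSum-refl x) ⟩
        sgn x * sgn x
          ≡⟨ -1^-square (ρ x) ⟩
        1ℤ  ∎
        where open ≡-Reasoning

      intervalSumᴮ-top : ∀ {p : T (bierCond P I x y)} → intervalSumᴮ (interval x y p) 1̂ᴮ ≡ 0ℤ
      intervalSumᴮ-top {p} with bier-elim p
      ... | Ix , ¬Iy , x≤y = begin
        intervalSumᴮ (interval x y p) 1̂ᴮ
          ≡⟨ ∑-elementsᴮ (weightᴮ (interval x y p) 1̂ᴮ) G (λ _ _ _ → refl) ⟩
        1ℤ * sgn 1̂ + (∑[ u ∈ L ] ∑[ v ∈ L ] ⟦ bierCond P I u v ⟧ * G u v)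
          ≡⟨ cong (1ℤ * sgn 1̂ +_) (∑-cong L (λ u → ∑-cong L (top-weight-splits u))) ⟩
        1ℤ * sgn 1̂ + (∑[ u ∈ L ] ∑[ v ∈ L ] (sgn 1̂ * (lowerInIdeal u v - upperInIdeal u v)))
          ≡⟨ cong (1ℤ * sgn 1̂ +_) (∑∑-*ˡ L L (sgn 1̂) (λ u v → lowerInIdeal u v - upperInIdeal u v)) ⟩
        1ℤ * sgn 1̂ + sgn 1̂ * (∑[ u ∈ L ] ∑[ v ∈ L ] (lowerInIdeal u v - upperInIdeal u v))
          ≡⟨ cong (λ t → 1ℤ * sgn 1̂ + sgn 1̂ * t) (trans (∑-cong L (λ u → ∑-- L)) (∑-- L)) ⟩
        1ℤ * sgn 1̂ + sgn 1̂ * ((∑[ u ∈ L ] ∑[ v ∈ L ] lowerInIdeal u v)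
                              - (∑[ u ∈ L ] ∑[ v ∈ L ] upperInIdeal u v))
          ≡⟨ cong₂ (λ s t → 1ℤ * sgn 1̂ + sgn 1̂ * (s - t)) (∑∑-lowerInIdeal ¬Iy) (∑∑-upperInIdeal Ix x≤y) ⟩
        1ℤ * sgn 1̂ + sgn 1̂ * (0ℤ - 1ℤ)
          ≡⟨ cancel (sgn 1̂) ⟩
        0ℤ  ∎
        where
        open ≡-Reasoning
        G : Carrier → Carrier → ℤ
        G u v = ⟦ (x ≤ᵇ u ∧ v ≤ᵇ y) ∧ true ⟧ * -1ℤ ^ (ρ u ℕ.+ corank v)
        cancel : ∀ a → 1ℤ * a + a * (0ℤ - 1ℤ) ≡ 0ℤ
        cancel = solve-∀

    intervalSumᴮ≡0 : ∀ {α β} → α B.< β → intervalSumᴮ α β ≡ 0ℤ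
    intervalSumᴮ≡0 {1̂ᴮ}             {1̂ᴮ}             (_ , α≢β) = contradiction refl α≢β
    intervalSumᴮ≡0 {interval x y _} {1̂ᴮ}             _         = intervalSumᴮ-top x y
    intervalSumᴮ≡0 {interval _ _ _} {interval _ _ _} α<β       = intervalSumᴮ-intervals α<β

    bier-eulerian : Eulerian (Bier P I)
    bier-eulerian =
      ((0̂ᴮ , 1̂ᴮ , 0̂ᴮ-min , λ _ → tt) , n , ρᴮ-isRank 1̂ᴮ) ,
      ρᴮ , ρᴮ-isRank , λ α β α<β → Bᴾ.∑≡0⇒balanced elementsᴮ ρᴮ {α} {β} (intervalSumᴮ≡0 α<β)

theorem3p1 : (P : FinPoset) (I : FinPoset.Carrier P → Bool) →
    Eulerian P → IsProperIdeal P I → Eulerian (Bier P I)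
theorem3p1 P I (((0̂ , 1̂ , 0̂-min , 1̂-max) , _) , ρ , isRank , balanced) (ideal , (x , Ix) , (y , ¬Iy)) =
  bier-eulerian 0̂-min 1̂-max isRank balanced 0̂∈I 1̂∉I
  where
  open BierEulerian P I ideal
  0̂∈I : T (I 0̂)
  0̂∈I = ideal 0̂ x (0̂-min x) Ix
  1̂∉I : ¬ T (I 1̂)
  1̂∉I I1̂ = ¬Iy (ideal y 1̂ (1̂-max y) I1̂)
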